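{- Let $\alpha(k)$ be the largest odd divisor of $k$, $V(n)=\sum_{k=1}^n\frac{\alpha(k)}{k}$ and $v(n)=V(n)-\frac{2n}{3}$. Let $m$ be a nonnegative integer. Then for every integer $n$ with $2^m\le n<2^{m+1}$, $$\frac{1}{3\cdot 2^m}\le v(n)\le \frac23-\frac{2-2^{ -m}}{3n},$$ where the lower bound is attained if and only if $n=2^m$, and the upper bound is attained if and only if $n=2^{m+1}-1$.
   Context: $\alpha(k)$ is the largest odd divisor of the positive integer $k$. -}

module Defs where

open import Data.Nat as ℕ using (ℕ; zero; suc; _^_; _%_)
open import Data.Nat.Divisibility using (_∣?_)
open import Data.List using (List; foldr; filter; applyUpTo)
open import Data.Integer using (+_)
open import Data.Rational using (ℚ; _/_; _+_; _-_; 0ℚ)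
open import Relation.Nullary.Decidable using (_×-dec_)
open import Relation.Binary.PropositionalEquality using (_≡_)

-- d is odd  ⇔  d % 2 ≡ 1
-- α k = the largest odd divisor of k : maximum of the odd divisors d of k with 1 ≤ d ≤ k
-- (for k ≥ 1 this list contains 1, so the maximum is the largest odd divisor)
α : ℕ → ℕ
α k = foldr ℕ._⊔_ 0
        (filter (λ d → (d ∣? k) ×-dec (d % 2 ℕ.≟ 1)) (applyUpTo suc k))

V : ℕ → ℚ
V zero    = 0ℚ
V (suc n) = V n + (+ α (suc n)) / suc n

v : ℕ → ℚ
v n = V n - (+ (2 ℕ.* n)) / 3

open import Data.Nat.Properties using (m^n>0; m*n≢0)

den₁-nonZero : ∀ m → ℕ.NonZero (3 ℕ.* 2 ^ m)
den₁-nonZero m = m*n≢0 3 (2 ^ m) {{_}} {{ℕ.>-nonZero (m^n>0 2 m)}}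

den₂-nonZero : ∀ m n → .{{ℕ.NonZero n}} → ℕ.NonZero (3 ℕ.* 2 ^ m ℕ.* n)
den₂-nonZero m n = m*n≢0 (3 ℕ.* 2 ^ m) n {{den₁-nonZero m}}

lowerBound : ℕ → ℚ
lowerBound m = _/_ (+ 1) (3 ℕ.* 2 ^ m) {{den₁-nonZero m}}

-- upper bound 2/3 - (2 - 2^{-m})/(3n) = 2/3 - (2^{m+1} - 1)/(3·2^m·n),  for n ≥ 1
upperBound : (m n : ℕ) → .{{ℕ.NonZero n}} → ℚ
upperBound m n = (+ 2) / 3 - _/_ (+ (2 ^ suc m ℕ.∸ 1)) (3 ℕ.* 2 ^ m ℕ.* n) {{den₂-nonZero m n}}

-- Since α(2k+1) = 2k+1 and α(2k) = α(k), splitting V(2q) into odd and even indices gives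
-- V(2q) = q + V(q)/2, hence v(2q) = v(q)/2 and v(2q+1) = v(q)/2 + 1/3, with v(1) = 1/3.
-- Unwinding these from 2^m ≤ n < 2^(m+1) down to 1 shows v(n) = r/(3·2^m), where r is n with
-- its m+1 binary digits reversed: 1 ≤ r < 2^(m+1), r = 1 exactly when n = 2^m, and
-- r = 2^(m+1) - 1 exactly when n = 2^(m+1) - 1.  The lower bound is r ≥ 1.  With K = 2^(m+1) - 1
-- the upper bound reads r·n + K ≤ (K+1)·n after clearing denominators; this is an equality when
-- r = n = K, and strict otherwise, because then r ≤ K - 1 and K < 2n.

module Submission where

open import Defs
open import Data.Nat as ℕ using (ℕ; zero; suc; _+_; _*_; _∸_; _^_; _%_; _⊔_; pred; NonZero; s≤s)
open import Data.Nat.Properties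
open import Data.Nat.Divisibility using (_∣_; _∣?_; ∣⇒≤; ∣-refl; 1∣_; 0∣⇒≡0; n∣m⇒m%n≡0; ∣n⇒∣m*n)
open import Data.Nat.DivMod using ([m+kn]%n≡m%n; m*n%n≡0)
open import Data.Nat.Coprimality using (Coprime; coprime-divisor)
open import Data.Nat.Tactic.RingSolver using (solve-∀)
open import Data.Integer as ℤ using (+_)
import Data.Integer.Properties as ℤ
open import Data.Rational as ℚ using (ℚ; _/_; _≤_; 1ℚ; toℚᵘ)
open import Data.Rational.Properties as ℚ
  using (toℚᵘ-injective; toℚᵘ-cong; toℚᵘ-fromℚᵘ; toℚᵘ-cancel-≤; toℚᵘ-homo-+; toℚᵘ-homo-*)
open import Data.Rational.Solver using (module +-*-Solver)
open import Data.Rational.Unnormalised as ℚᵘ using (mkℚᵘ; *≡*; *≤*) renaming (_≃_ to _≃ᵘ_)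
import Data.Rational.Unnormalised.Properties as ℚᵘ
open import Data.List using (List; foldr; filter; applyUpTo)
open import Data.List.Properties using (foldr-preservesᵒ)
import Data.List.Relation.Unary.Any as Any
open import Data.List.Membership.Propositional using (_∈_)
open import Data.List.Membership.Propositional.Properties
  using (foldr-selective; ∈-filter⁺; ∈-filter⁻; ∈-applyUpTo⁺)
open import Data.Product using (_×_; _,_; proj₁; proj₂)
open import Data.Sum using (inj₁; inj₂; [_,_]′)
open import Function.Bundles using (_⇔_; mk⇔; Equivalence)
open import Relation.Nullary using (Dec; contradiction; yes; no)
open import Relation.Nullary.Decidable using (_×-dec_)
open import Relation.Binary.PropositionalEquality
import Relation.Binary.Reasoning.Setoid as SetoidReasoning
open import Function.Properties.Equivalence using (⇔-setoid)
open import Level using (0ℓ)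

open +-*-Solver

q+q≡q*2 : ∀ q → q + q ≡ q * 2
q+q≡q*2 = solve-∀

[1+q+q]%2≡1 : ∀ q → suc (q + q) % 2 ≡ 1
[1+q+q]%2≡1 q = trans (cong (λ n → suc n % 2) (q+q≡q*2 q)) ([m+kn]%n≡m%n 1 q 2)

1+q+q≢p+p : ∀ q p → suc (q + q) ≢ p + p
1+q+q≢p+p q p eq = contradiction
  (trans (sym ([1+q+q]%2≡1 q)) (trans (cong (_% 2) (trans eq (q+q≡q*2 p))) (m*n%n≡0 p 2)))
  λ ()

m+m≤n+n⇒m≤n : ∀ {m n} → m + m ℕ.≤ n + n → m ℕ.≤ n
m+m≤n+n⇒m≤n m+m≤n+n = ≮⇒≥ λ n<m → <⇒≱ (+-mono-< n<m n<m) m+m≤n+n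

m+m<n+n⇒m<n : ∀ {m n} → m + m ℕ.< n + n → m ℕ.< n
m+m<n+n⇒m<n m+m<n+n = ≰⇒> λ n≤m → <⇒≱ m+m<n+n (+-mono-≤ n≤m n≤m)

m+m≤1+n+n⇒m≤n : ∀ {m n} → m + m ℕ.≤ suc (n + n) → m ℕ.≤ n
m+m≤1+n+n⇒m≤n {m} {n} m+m≤1+n+n = ≮⇒≥ λ n<m →
  <⇒≱ (≤-trans (s≤s (≤-reflexive (sym (+-suc n n)))) (+-mono-≤ n<m n<m)) m+m≤1+n+n

+-double-injective : ∀ {m n} → m + m ≡ n + n → m ≡ n
+-double-injective eq = ≤-antisym (m+m≤n+n⇒m≤n (≤-reflexive eq)) (m+m≤n+n⇒m≤n (≤-reflexive (sym eq)))

2^[1+m]≡2^m+2^m : ∀ m → 2 ^ suc m ≡ 2 ^ m + 2 ^ m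
2^[1+m]≡2^m+2^m m = sym (trans (q+q≡q*2 (2 ^ m)) (*-comm (2 ^ m) 2))

data Halves : ℕ → Set where
  twice   : ∀ q → Halves (q + q)
  twice+1 : ∀ q → Halves (suc (q + q))

halves : ∀ n → Halves n
halves zero = twice 0
halves (suc n) with halves n
... | twice q   = twice+1 q
... | twice+1 q = subst Halves (cong suc (+-suc q q)) (twice (suc q))

r*n+[N∸1]≤N*n : ∀ {r n N} → r ℕ.< N → N ℕ.≤ n + n → (suc r ≡ N ⇔ suc n ≡ N) →
  (r * n + (N ∸ 1) ℕ.≤ N * n) × (r * n + (N ∸ 1) ≡ N * n ⇔ n ≡ N ∸ 1)
r*n+[N∸1]≤N*n {r} {n} {suc K} r<N N≤n+n 1+r≡N⇔1+n≡N with r ℕ.≟ K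
... | yes refl = ≤-reflexive eq , mk⇔ (λ _ → n≡K) (λ _ → eq)
  where
  n≡K : n ≡ K
  n≡K = suc-injective (Equivalence.to 1+r≡N⇔1+n≡N refl)
  eq : r * n + r ≡ suc r * n
  eq = trans (cong (λ x → r * x + r) n≡K) (trans (+-comm (r * r) r) (cong (suc r *_) (sym n≡K)))
... | no r≢K = <⇒≤ strict , mk⇔ (λ eq → contradiction eq (<⇒≢ strict))
  (λ n≡K → contradiction (suc-injective (Equivalence.from 1+r≡N⇔1+n≡N (cong suc n≡K))) r≢K)
  where
  strict : r * n + K ℕ.< suc K * n
  strict = begin-strict
    r * n + K           <⟨ +-monoʳ-< (r * n) N≤n+n ⟩
    r * n + (n + n)     ≡⟨ trans (+-comm (r * n) (n + n)) (+-assoc n n (r * n)) ⟩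
    suc (suc r) * n     ≤⟨ *-monoˡ-≤ n (s≤s (≤∧≢⇒< (≤-pred r<N) r≢K)) ⟩
    suc K * n           ∎
    where open ≤-Reasoning

∈⇒≤-foldr-⊔ : ∀ {x} xs → x ∈ xs → x ℕ.≤ foldr _⊔_ 0 xs
∈⇒≤-foldr-⊔ xs x∈xs = foldr-preservesᵒ
  (λ a b → [ m≤n⇒m≤n⊔o b , m≤n⇒m≤o⊔n a ]′) 0 xs (inj₂ (Any.map ≤-reflexive x∈xs))

oddDivisor? : ∀ k d → Dec (d ∣ k × d % 2 ≡ 1)
oddDivisor? k d = (d ∣? k) ×-dec (d % 2 ℕ.≟ 1)

oddDivisors : ℕ → List ℕ
oddDivisors k = filter (oddDivisor? k) (applyUpTo suc k)

odd∣⇒≤α : ∀ {d k} .{{_ : NonZero k}} → d ∣ k → d % 2 ≡ 1 → d ℕ.≤ α k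
odd∣⇒≤α {suc d} {k} d∣k odd = ∈⇒≤-foldr-⊔ (oddDivisors k)
  (∈-filter⁺ (oddDivisor? k) (∈-applyUpTo⁺ suc (∣⇒≤ d∣k)) (d∣k , odd))

α-oddDivisor : ∀ k .{{_ : NonZero k}} → α k ∣ k × α k % 2 ≡ 1
α-oddDivisor k with foldr-selective ⊔-sel 0 (oddDivisors k)
... | inj₁ α≡0 = contradiction (subst (1 ℕ.≤_) α≡0 (odd∣⇒≤α (1∣ k) refl)) λ ()
... | inj₂ α∈  = proj₂ (∈-filter⁻ (oddDivisor? k) {xs = applyUpTo suc k} α∈)

odd⇒α≡id : ∀ d → d % 2 ≡ 1 → α d ≡ d
odd⇒α≡id (suc d) odd = ≤-antisym (∣⇒≤ (proj₁ (α-oddDivisor (suc d)))) (odd∣⇒≤α ∣-refl odd)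

odd⇒coprime[d,2] : ∀ {d} → d % 2 ≡ 1 → Coprime d 2
odd⇒coprime[d,2] odd {0}     (_ , 0∣2) = contradiction (0∣⇒≡0 0∣2) λ ()
odd⇒coprime[d,2] odd {1}     _         = refl
odd⇒coprime[d,2] odd {2}     (2∣d , _) = contradiction (trans (sym odd) (n∣m⇒m%n≡0 _ 2 2∣d)) λ ()
odd⇒coprime[d,2] odd {suc (suc (suc i))} (_ , i∣2) = contradiction (∣⇒≤ i∣2) λ { (s≤s (s≤s ())) }

α[k+k]≡α[k] : ∀ k → α (suc k + suc k) ≡ α (suc k)
α[k+k]≡α[k] k with α-oddDivisor (suc k) | α-oddDivisor (suc k + suc k)
... | αk∣k , αk-odd | α2k∣2k , α2k-odd = ≤-antisym
  (odd∣⇒≤α (coprime-divisor (odd⇒coprime[d,2] α2k-odd) (subst (α (suc k + suc k) ∣_) k+k≡2*k α2k∣2k))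
            α2k-odd)
  (odd∣⇒≤α (subst (α (suc k) ∣_) (sym k+k≡2*k) (∣n⇒∣m*n 2 αk∣k)) αk-odd)
  where
  k+k≡2*k : suc k + suc k ≡ 2 * suc k
  k+k≡2*k = trans (q+q≡q*2 (suc k)) (*-comm (suc k) 2)

_÷_ : ℕ → (d : ℕ) → .{{NonZero d}} → ℚ
a ÷ d = + a / d

toℚᵘ-÷ : ∀ a d .{{_ : NonZero d}} → toℚᵘ (a ÷ d) ≃ᵘ mkℚᵘ (+ a) (pred d)
toℚᵘ-÷ a (suc d) = toℚᵘ-fromℚᵘ (mkℚᵘ (+ a) d)

÷≡÷⇔ : ∀ a b c d .{{_ : NonZero b}} .{{_ : NonZero d}} → a ÷ b ≡ c ÷ d ⇔ a * d ≡ c * b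
÷≡÷⇔ a b@(suc _) c d@(suc _) = mk⇔ to from
  where
  to : a ÷ b ≡ c ÷ d → a * d ≡ c * b
  to eq with ℚᵘ.≃-trans (ℚᵘ.≃-sym (toℚᵘ-÷ a b)) (ℚᵘ.≃-trans (toℚᵘ-cong eq) (toℚᵘ-÷ c d))
  ... | *≡* ad≡cb = ℤ.+-injective (trans (ℤ.pos-* a d) (trans ad≡cb (sym (ℤ.pos-* c b))))
  from : a * d ≡ c * b → a ÷ b ≡ c ÷ d
  from ad≡cb = toℚᵘ-injective (ℚᵘ.≃-trans (toℚᵘ-÷ a b) (ℚᵘ.≃-trans
    (*≡* (trans (sym (ℤ.pos-* a d)) (trans (cong +_ ad≡cb) (ℤ.pos-* c b)))) (ℚᵘ.≃-sym (toℚᵘ-÷ c d))))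

÷-injective : ∀ a b d .{{_ : NonZero d}} → a ÷ d ≡ b ÷ d → a ≡ b
÷-injective a b d eq = *-cancelʳ-≡ a b d (Equivalence.to (÷≡÷⇔ a d b d) eq)

*≤*⇒÷≤÷ : ∀ a b c d .{{_ : NonZero b}} .{{_ : NonZero d}} → a * d ℕ.≤ c * b → a ÷ b ≤ c ÷ d
*≤*⇒÷≤÷ a b@(suc _) c d@(suc _) ad≤cb = toℚᵘ-cancel-≤
  (ℚᵘ.≤-respˡ-≃ (ℚᵘ.≃-sym (toℚᵘ-÷ a b)) (ℚᵘ.≤-respʳ-≃ (ℚᵘ.≃-sym (toℚᵘ-÷ c d))
    (*≤* (subst₂ ℤ._≤_ (ℤ.pos-* a d) (ℤ.pos-* c b) (ℤ.+≤+ ad≤cb)))))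

÷+÷ : ∀ a b c d .{{_ : NonZero b}} .{{_ : NonZero d}} →
      a ÷ b ℚ.+ c ÷ d ≡ _÷_ (a * d + c * b) (b * d) {{m*n≢0 b d}}
÷+÷ a b@(suc _) c d@(suc _) = toℚᵘ-injective (begin
  toℚᵘ (a ÷ b ℚ.+ c ÷ d)                  ≈⟨ toℚᵘ-homo-+ (a ÷ b) (c ÷ d) ⟩
  toℚᵘ (a ÷ b) ℚᵘ.+ toℚᵘ (c ÷ d)          ≈⟨ ℚᵘ.+-cong (toℚᵘ-÷ a b) (toℚᵘ-÷ c d) ⟩
  mkℚᵘ (+ a ℤ.* + d ℤ.+ + c ℤ.* + b) _    ≡⟨ cong (λ i → mkℚᵘ i (pred (b * d))) numerator ⟩
  mkℚᵘ (+ (a * d + c * b)) (pred (b * d)) ≈⟨ ℚᵘ.≃-sym (toℚᵘ-÷ (a * d + c * b) (b * d)) ⟩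
  toℚᵘ ((a * d + c * b) ÷ (b * d))        ∎)
  where
  open ℚᵘ.≃-Reasoning
  numerator : + a ℤ.* + d ℤ.+ + c ℤ.* + b ≡ + (a * d + c * b)
  numerator = sym (trans (ℤ.pos-+ (a * d) (c * b)) (cong₂ ℤ._+_ (ℤ.pos-* a d) (ℤ.pos-* c b)))

÷*÷ : ∀ a b c d .{{_ : NonZero b}} .{{_ : NonZero d}} →
      (a ÷ b) ℚ.* (c ÷ d) ≡ _÷_ (a * c) (b * d) {{m*n≢0 b d}}
÷*÷ a b@(suc _) c d@(suc _) = toℚᵘ-injective (begin
  toℚᵘ ((a ÷ b) ℚ.* (c ÷ d))              ≈⟨ toℚᵘ-homo-* (a ÷ b) (c ÷ d) ⟩
  toℚᵘ (a ÷ b) ℚᵘ.* toℚᵘ (c ÷ d)          ≈⟨ ℚᵘ.*-cong (toℚᵘ-÷ a b) (toℚᵘ-÷ c d) ⟩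
  mkℚᵘ (+ a ℤ.* + c) (pred (b * d))       ≡⟨ cong (λ i → mkℚᵘ i (pred (b * d))) (sym (ℤ.pos-* a c)) ⟩
  mkℚᵘ (+ (a * c)) (pred (b * d))         ≈⟨ ℚᵘ.≃-sym (toℚᵘ-÷ (a * c) (b * d)) ⟩
  toℚᵘ ((a * c) ÷ (b * d))                ∎)
  where open ℚᵘ.≃-Reasoning

p+r≤q⇒p≤q-r : ∀ p q r → p ℚ.+ r ≤ q → p ≤ q ℚ.- r
p+r≤q⇒p≤q-r p q r p+r≤q =
  subst (_≤ q ℚ.- r) (solve 2 (λ p r → p :+ r :- r := p) refl p r) (ℚ.+-monoˡ-≤ (ℚ.- r) p+r≤q)

p≡q-r⇔p+r≡q : ∀ p q r → p ≡ q ℚ.- r ⇔ p ℚ.+ r ≡ q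
p≡q-r⇔p+r≡q p q r = mk⇔
  (λ p≡q-r → trans (cong (ℚ._+ r) p≡q-r) (solve 2 (λ q r → q :- r :+ r := q) refl q r))
  (λ p+r≡q → trans (solve 2 (λ p r → p := p :+ r :- r) refl p r) (cong (ℚ._- r) p+r≡q))

÷1-+ : ∀ a b → (a + b) ÷ 1 ≡ a ÷ 1 ℚ.+ b ÷ 1
÷1-+ a b = sym (trans (÷+÷ a 1 b 1) (Equivalence.from (÷≡÷⇔ (a * 1 + b * 1) 1 (a + b) 1) (cross a b)))
  where
  cross : ∀ a b → (a * 1 + b * 1) * 1 ≡ (a + b) * (1 * 1)
  cross = solve-∀

n÷n≡1 : ∀ n .{{_ : NonZero n}} → n ÷ n ≡ 1ℚ
n÷n≡1 n = Equivalence.from (÷≡÷⇔ n n 1 1) (trans (*-identityʳ n) (sym (*-identityˡ n)))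

½ ⅓ ⅔ : ℚ
½ = 1 ÷ 2
⅓ = 1 ÷ 3
⅔ = 2 ÷ 3

a÷[b+b]≡½*a÷b : ∀ a b → a ÷ (suc b + suc b) ≡ ½ ℚ.* (a ÷ suc b)
a÷[b+b]≡½*a÷b a b = sym (trans (÷*÷ 1 2 a (suc b))
  (Equivalence.from (÷≡÷⇔ (1 * a) (2 * suc b) a (suc b + suc b)) (cross a (suc b))))
  where
  cross : ∀ a b → 1 * a * (b + b) ≡ a * (2 * b)
  cross = solve-∀

2n÷3≡⅔*n : ∀ n → (2 * n) ÷ 3 ≡ ⅔ ℚ.* (n ÷ 1)
2n÷3≡⅔*n n = sym (÷*÷ 2 3 n 1)

α[1+2q]÷[1+2q]≡1 : ∀ q → α (suc (q + q)) ÷ suc (q + q) ≡ 1ℚ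
α[1+2q]÷[1+2q]≡1 q =
  trans (cong (λ a → a ÷ suc (q + q)) (odd⇒α≡id (suc (q + q)) ([1+q+q]%2≡1 q))) (n÷n≡1 (suc (q + q)))

α[2+2q]÷[2+2q]≡½*α[1+q]÷[1+q] : ∀ q → α (suc (suc (q + q))) ÷ suc (suc (q + q)) ≡ ½ ℚ.* (α (suc q) ÷ suc q)
α[2+2q]÷[2+2q]≡½*α[1+q]÷[1+q] q = subst (λ n → α (suc n) ÷ suc n ≡ ½ ℚ.* (α (suc q) ÷ suc q)) (+-suc q q)
  (trans (cong (λ a → a ÷ (suc q + suc q)) (α[k+k]≡α[k] q)) (a÷[b+b]≡½*a÷b (α (suc q)) q))

V-double : ∀ q → V (q + q) ≡ q ÷ 1 ℚ.+ ½ ℚ.* V q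
V-double zero    = refl
V-double (suc q) = begin
  V (suc q + suc q)
    ≡⟨ cong (λ n → V (suc n)) (+-suc q q) ⟩
  V (q + q) ℚ.+ α (suc (q + q)) ÷ suc (q + q) ℚ.+ α (suc (suc (q + q))) ÷ suc (suc (q + q))
    ≡⟨ cong₂ ℚ._+_ (cong₂ ℚ._+_ (V-double q) (α[1+2q]÷[1+2q]≡1 q)) (α[2+2q]÷[2+2q]≡½*α[1+q]÷[1+q] q) ⟩
  q ÷ 1 ℚ.+ ½ ℚ.* V q ℚ.+ 1ℚ ℚ.+ ½ ℚ.* (α (suc q) ÷ suc q)
    ≡⟨ solve 3 (λ i w x → i :+ con ½ :* w :+ con 1ℚ :+ con ½ :* x := (con 1ℚ :+ i) :+ con ½ :* (w :+ x))
         refl (q ÷ 1) (V q) (α (suc q) ÷ suc q) ⟩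
  (1ℚ ℚ.+ q ÷ 1) ℚ.+ ½ ℚ.* V (suc q)
    ≡⟨ cong (ℚ._+ ½ ℚ.* V (suc q)) (sym (÷1-+ 1 q)) ⟩
  suc q ÷ 1 ℚ.+ ½ ℚ.* V (suc q) ∎
  where open ≡-Reasoning

v-double : ∀ q → v (q + q) ≡ ½ ℚ.* v q
v-double q = begin
  V (q + q) ℚ.- (2 * (q + q)) ÷ 3
    ≡⟨ cong₂ ℚ._-_ (V-double q) (trans (2n÷3≡⅔*n (q + q)) (cong (⅔ ℚ.*_) (÷1-+ q q))) ⟩
  (q ÷ 1 ℚ.+ ½ ℚ.* V q) ℚ.- ⅔ ℚ.* (q ÷ 1 ℚ.+ q ÷ 1)
    ≡⟨ solve 2 (λ i w → (i :+ con ½ :* w) :- con ⅔ :* (i :+ i) := con ½ :* (w :- con ⅔ :* i)) refl (q ÷ 1) (V q) ⟩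
  ½ ℚ.* (V q ℚ.- ⅔ ℚ.* (q ÷ 1))
    ≡⟨ cong (λ x → ½ ℚ.* (V q ℚ.- x)) (sym (2n÷3≡⅔*n q)) ⟩
  ½ ℚ.* v q ∎
  where open ≡-Reasoning

v-double+1 : ∀ q → v (suc (q + q)) ≡ ½ ℚ.* v q ℚ.+ ⅓
v-double+1 q = begin
  V (q + q) ℚ.+ α (suc (q + q)) ÷ suc (q + q) ℚ.- (2 * suc (q + q)) ÷ 3
    ≡⟨ cong₂ ℚ._-_ (cong₂ ℚ._+_ (V-double q) (α[1+2q]÷[1+2q]≡1 q)) 2[1+2q]÷3 ⟩
  (q ÷ 1 ℚ.+ ½ ℚ.* V q ℚ.+ 1ℚ) ℚ.- ⅔ ℚ.* (1ℚ ℚ.+ (q ÷ 1 ℚ.+ q ÷ 1))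
    ≡⟨ solve 2 (λ i w → (i :+ con ½ :* w :+ con 1ℚ) :- con ⅔ :* (con 1ℚ :+ (i :+ i))
                        := con ½ :* (w :- con ⅔ :* i) :+ con ⅓) refl (q ÷ 1) (V q) ⟩
  ½ ℚ.* (V q ℚ.- ⅔ ℚ.* (q ÷ 1)) ℚ.+ ⅓
    ≡⟨ cong (λ x → ½ ℚ.* (V q ℚ.- x) ℚ.+ ⅓) (sym (2n÷3≡⅔*n q)) ⟩
  ½ ℚ.* v q ℚ.+ ⅓ ∎
  where
  open ≡-Reasoning
  2[1+2q]÷3 : (2 * suc (q + q)) ÷ 3 ≡ ⅔ ℚ.* (1ℚ ℚ.+ (q ÷ 1 ℚ.+ q ÷ 1))
  2[1+2q]÷3 = trans (2n÷3≡⅔*n (suc (q + q)))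
    (cong (⅔ ℚ.*_) (trans (÷1-+ 1 (q + q)) (cong (1ℚ ℚ.+_) (÷1-+ q q))))

infix 8 _/3·2^_ _/[3·2^_·_]

_/3·2^_ : ℕ → ℕ → ℚ
r /3·2^ m = _÷_ r (3 * 2 ^ m) {{den₁-nonZero m}}

½*r/3·2^m≡r/3·2^[1+m] : ∀ r m → ½ ℚ.* (r /3·2^ m) ≡ r /3·2^ suc m
½*r/3·2^m≡r/3·2^[1+m] r m = trans (÷*÷ 1 2 r (3 * 2 ^ m) {{_}} {{den₁-nonZero m}})
  (Equivalence.from (÷≡÷⇔ (1 * r) (2 * (3 * 2 ^ m)) r (3 * 2 ^ suc m)
     {{m*n≢0 2 (3 * 2 ^ m) {{_}} {{den₁-nonZero m}}}} {{den₁-nonZero (suc m)}}) (cross r (2 ^ m)))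
  where
  cross : ∀ r p → 1 * r * (3 * (2 * p)) ≡ r * (2 * (3 * p))
  cross = solve-∀

r/3·2^m+⅓≡[r+2^m]/3·2^m : ∀ r m → r /3·2^ m ℚ.+ ⅓ ≡ (r + 2 ^ m) /3·2^ m
r/3·2^m+⅓≡[r+2^m]/3·2^m r m = trans (÷+÷ r (3 * 2 ^ m) 1 3 {{den₁-nonZero m}})
  (Equivalence.from (÷≡÷⇔ (r * 3 + 1 * (3 * 2 ^ m)) (3 * 2 ^ m * 3) (r + 2 ^ m) (3 * 2 ^ m)
     {{m*n≢0 (3 * 2 ^ m) 3 {{den₁-nonZero m}}}} {{den₁-nonZero m}}) (cross r (2 ^ m)))
  where
  cross : ∀ r p → (r * 3 + 1 * (3 * p)) * (3 * p) ≡ (r + p) * (3 * p * 3)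
  cross = solve-∀

record ReversedDigits (m n : ℕ) : Set where
  field
    rev            : ℕ
    v≡rev/3·2^m    : v n ≡ rev /3·2^ m
    1≤rev          : 1 ℕ.≤ rev
    rev<2^[1+m]    : rev ℕ.< 2 ^ suc m
    rev≡1⇔         : rev ≡ 1 ⇔ n ≡ 2 ^ m
    1+rev≡2^[1+m]⇔ : suc rev ≡ 2 ^ suc m ⇔ suc n ≡ 2 ^ suc m

reversedDigits-double : ∀ {m q} → ReversedDigits m q → ReversedDigits (suc m) (q + q)
reversedDigits-double {m} {q} R = record
  { rev            = rev
  ; v≡rev/3·2^m    = trans (v-double q) (trans (cong (½ ℚ.*_) v≡rev/3·2^m) (½*r/3·2^m≡r/3·2^[1+m] rev m))
  ; 1≤rev          = 1≤rev
  ; rev<2^[1+m]    = <-≤-trans rev<2^[1+m] (m≤m+n (2 ^ suc m) _)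
  ; rev≡1⇔         = mk⇔
      (λ rev≡1 → trans (cong (λ x → x + x) (Equivalence.to rev≡1⇔ rev≡1)) (sym (2^[1+m]≡2^m+2^m m)))
      (λ q+q≡ → Equivalence.from rev≡1⇔ (+-double-injective (trans q+q≡ (2^[1+m]≡2^m+2^m m))))
  ; 1+rev≡2^[1+m]⇔ = mk⇔
      (λ 1+rev≡ → contradiction 1+rev≡ (<⇒≢ (<-≤-trans (s≤s rev<2^[1+m]) 2^[1+m]<2^[2+m])))
      (λ 1+q+q≡ → contradiction (trans 1+q+q≡ (2^[1+m]≡2^m+2^m (suc m))) (1+q+q≢p+p q (2 ^ suc m)))
  }
  where
  open ReversedDigits R
  2^[1+m]<2^[2+m] : 2 ^ suc m ℕ.< 2 ^ suc (suc m)
  2^[1+m]<2^[2+m] = subst (2 ^ suc m ℕ.<_) (sym (2^[1+m]≡2^m+2^m (suc m))) (m<m+n (2 ^ suc m) (m^n>0 2 (suc m)))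

reversedDigits-double+1 : ∀ {m q} → ReversedDigits m q → ReversedDigits (suc m) (suc (q + q))
reversedDigits-double+1 {m} {q} R = record
  { rev            = rev + 2 ^ suc m
  ; v≡rev/3·2^m    = begin
      v (suc (q + q))                         ≡⟨ v-double+1 q ⟩
      ½ ℚ.* v q ℚ.+ ⅓                         ≡⟨ cong (λ x → ½ ℚ.* x ℚ.+ ⅓) v≡rev/3·2^m ⟩
      ½ ℚ.* (rev /3·2^ m) ℚ.+ ⅓               ≡⟨ cong (ℚ._+ ⅓) (½*r/3·2^m≡r/3·2^[1+m] rev m) ⟩
      rev /3·2^ suc m ℚ.+ ⅓                   ≡⟨ r/3·2^m+⅓≡[r+2^m]/3·2^m rev (suc m) ⟩
      (rev + 2 ^ suc m) /3·2^ suc m           ∎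
  ; 1≤rev          = ≤-trans 1≤rev (m≤m+n rev _)
  ; rev<2^[1+m]    = subst (rev + 2 ^ suc m ℕ.<_) (sym 2N≡N+N) (+-monoˡ-< N rev<2^[1+m])
  ; rev≡1⇔         = mk⇔
      (λ rev+2^[1+m]≡1 → contradiction rev+2^[1+m]≡1 (>⇒≢ (+-mono-≤ 1≤rev (m^n>0 2 (suc m)))))
      (λ 1+q+q≡ → contradiction (trans 1+q+q≡ (2^[1+m]≡2^m+2^m m)) (1+q+q≢p+p q (2 ^ m)))
  ; 1+rev≡2^[1+m]⇔ = mk⇔
      (λ 1+rev+N≡2N → begin
        suc (suc (q + q))  ≡⟨ 2+q+q≡1+q+1+q ⟩
        suc q + suc q      ≡⟨ cong (λ x → x + x) (Equivalence.to 1+rev≡2^[1+m]⇔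
                                (+-cancelʳ-≡ N (suc rev) N (trans 1+rev+N≡2N 2N≡N+N))) ⟩
        N + N              ≡⟨ sym 2N≡N+N ⟩
        2 ^ suc (suc m)    ∎)
      (λ 2+q+q≡2N → trans (cong (_+ N) (Equivalence.from 1+rev≡2^[1+m]⇔
        (+-double-injective (trans (sym 2+q+q≡1+q+1+q) (trans 2+q+q≡2N 2N≡N+N)))))
        (sym 2N≡N+N))
  }
  where
  open ≡-Reasoning
  open ReversedDigits R
  N : ℕ
  N = 2 ^ suc m
  2N≡N+N : 2 ^ suc (suc m) ≡ N + N
  2N≡N+N = 2^[1+m]≡2^m+2^m (suc m)
  2+q+q≡1+q+1+q : suc (suc (q + q)) ≡ suc q + suc q
  2+q+q≡1+q+1+q = cong suc (sym (+-suc q q))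

reversedDigits : ∀ m n → 2 ^ m ℕ.≤ n → n ℕ.< 2 ^ suc m → ReversedDigits m n
reversedDigits zero zero () _
reversedDigits zero 1 _ _ = record
  { rev = 1 ; v≡rev/3·2^m = refl ; 1≤rev = ≤-refl ; rev<2^[1+m] = ≤-refl
  ; rev≡1⇔ = mk⇔ (λ _ → refl) (λ _ → refl) ; 1+rev≡2^[1+m]⇔ = mk⇔ (λ _ → refl) (λ _ → refl) }
reversedDigits zero (suc (suc n)) _ (s≤s (s≤s ()))
reversedDigits (suc m) n lo hi with halves n
... | twice q   = reversedDigits-double (reversedDigits m q
        (m+m≤n+n⇒m≤n (subst (ℕ._≤ q + q) (2^[1+m]≡2^m+2^m m) lo))
        (m+m<n+n⇒m<n (subst (q + q ℕ.<_) (2^[1+m]≡2^m+2^m (suc m)) hi)))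
... | twice+1 q = reversedDigits-double+1 (reversedDigits m q
        (m+m≤1+n+n⇒m≤n (subst (ℕ._≤ suc (q + q)) (2^[1+m]≡2^m+2^m m) lo))
        (m+m<n+n⇒m<n (<-trans (n<1+n (q + q)) (subst (suc (q + q) ℕ.<_) (2^[1+m]≡2^m+2^m (suc m)) hi))))

_/[3·2^_·_] : ℕ → (m n : ℕ) → .{{NonZero n}} → ℚ
x /[3·2^ m · n ] = _÷_ x (3 * 2 ^ m * n) {{den₂-nonZero m n}}

a/3·2^m+b/3·2^m·n : ∀ a b m n .{{_ : NonZero n}} → a /3·2^ m ℚ.+ b /[3·2^ m · n ] ≡ (a * n + b) /[3·2^ m · n ]
a/3·2^m+b/3·2^m·n a b m n = trans (÷+÷ a (3 * 2 ^ m) b (3 * 2 ^ m * n) {{den₁-nonZero m}} {{den₂-nonZero m n}})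
  (Equivalence.from (÷≡÷⇔ (a * (3 * 2 ^ m * n) + b * (3 * 2 ^ m)) (3 * 2 ^ m * (3 * 2 ^ m * n))
                          (a * n + b) (3 * 2 ^ m * n)
     {{m*n≢0 (3 * 2 ^ m) (3 * 2 ^ m * n) {{den₁-nonZero m}} {{den₂-nonZero m n}}}} {{den₂-nonZero m n}})
     (cross a b (3 * 2 ^ m) n))
  where
  cross : ∀ a b d n → (a * (d * n) + b * d) * (d * n) ≡ (a * n + b) * (d * (d * n))
  cross = solve-∀

x/3·2^m·n≤⅔ : ∀ x m n .{{_ : NonZero n}} → x ℕ.≤ 2 ^ suc m * n → x /[3·2^ m · n ] ≤ ⅔
x/3·2^m·n≤⅔ x m n x≤ = *≤*⇒÷≤÷ x (3 * 2 ^ m * n) 2 3 {{den₂-nonZero m n}}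
  (subst (x * 3 ℕ.≤_) (cross (2 ^ m) n) (*-monoˡ-≤ 3 x≤))
  where
  cross : ∀ p n → 2 * p * n * 3 ≡ 2 * (3 * p * n)
  cross = solve-∀

x/3·2^m·n≡⅔⇔ : ∀ x m n .{{_ : NonZero n}} → x /[3·2^ m · n ] ≡ ⅔ ⇔ x ≡ 2 ^ suc m * n
x/3·2^m·n≡⅔⇔ x m n = mk⇔
  (λ eq → *-cancelʳ-≡ x (2 ^ suc m * n) 3 (trans (Equivalence.to cross-mult eq) (sym (cross (2 ^ m) n))))
  (λ eq → Equivalence.from cross-mult (trans (cong (_* 3) eq) (cross (2 ^ m) n)))
  where
  cross-mult : x /[3·2^ m · n ] ≡ ⅔ ⇔ x * 3 ≡ 2 * (3 * 2 ^ m * n)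
  cross-mult = ÷≡÷⇔ x (3 * 2 ^ m * n) 2 3 {{den₂-nonZero m n}}
  cross : ∀ p n → 2 * p * n * 3 ≡ 2 * (3 * p * n)
  cross = solve-∀

module _ {m n} .{{_ : NonZero n}} (R : ReversedDigits m n) where
  open ReversedDigits R

  lowerBound≤v : lowerBound m ≤ v n
  lowerBound≤v = subst (lowerBound m ≤_) (sym v≡rev/3·2^m)
    (*≤*⇒÷≤÷ 1 (3 * 2 ^ m) rev (3 * 2 ^ m) {{den₁-nonZero m}} {{den₁-nonZero m}} (*-monoˡ-≤ (3 * 2 ^ m) 1≤rev))

  lowerBound≡v⇔ : lowerBound m ≡ v n ⇔ n ≡ 2 ^ m
  lowerBound≡v⇔ = mk⇔
    (λ eq → Equivalence.to rev≡1⇔ (sym (÷-injective 1 rev (3 * 2 ^ m) {{den₁-nonZero m}} (trans eq v≡rev/3·2^m))))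
    (λ n≡2^m → trans (cong (_/3·2^ m) (sym (Equivalence.from rev≡1⇔ n≡2^m))) (sym v≡rev/3·2^m))

  module _ (2^m≤n : 2 ^ m ℕ.≤ n) where
    private
      K : ℕ
      K = 2 ^ suc m ∸ 1

      bound : (rev * n + K ℕ.≤ 2 ^ suc m * n) × (rev * n + K ≡ 2 ^ suc m * n ⇔ n ≡ K)
      bound = r*n+[N∸1]≤N*n rev<2^[1+m]
        (subst (ℕ._≤ n + n) (sym (2^[1+m]≡2^m+2^m m)) (+-mono-≤ 2^m≤n 2^m≤n)) 1+rev≡2^[1+m]⇔

      v+K/3·2^m·n : v n ℚ.+ K /[3·2^ m · n ] ≡ (rev * n + K) /[3·2^ m · n ]
      v+K/3·2^m·n = trans (cong (ℚ._+ K /[3·2^ m · n ]) v≡rev/3·2^m) (a/3·2^m+b/3·2^m·n rev K m n)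

    v≤upperBound : v n ≤ upperBound m n
    v≤upperBound = p+r≤q⇒p≤q-r (v n) ⅔ (K /[3·2^ m · n ])
      (subst (_≤ ⅔) (sym v+K/3·2^m·n) (x/3·2^m·n≤⅔ (rev * n + K) m n (proj₁ bound)))

    v≡upperBound⇔ : v n ≡ upperBound m n ⇔ n ≡ 2 ^ suc m ∸ 1
    v≡upperBound⇔ = begin
      v n ≡ ⅔ ℚ.- K /[3·2^ m · n ]             ≈⟨ p≡q-r⇔p+r≡q (v n) ⅔ (K /[3·2^ m · n ]) ⟩
      v n ℚ.+ K /[3·2^ m · n ] ≡ ⅔             ≡⟨ cong (_≡ ⅔) v+K/3·2^m·n ⟩
      (rev * n + K) /[3·2^ m · n ] ≡ ⅔         ≈⟨ x/3·2^m·n≡⅔⇔ (rev * n + K) m n ⟩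
      rev * n + K ≡ 2 ^ suc m * n              ≈⟨ proj₂ bound ⟩
      n ≡ K                                    ∎
      where open SetoidReasoning (⇔-setoid 0ℓ)

corollary4 : (m n : ℕ) → .{{_ : NonZero n}} → 2 ^ m ℕ.≤ n → n ℕ.< 2 ^ suc m →
    (lowerBound m ≤ v n) × (v n ≤ upperBound m n)
    × ((lowerBound m ≡ v n) ⇔ (n ≡ 2 ^ m))
    × ((v n ≡ upperBound m n) ⇔ (n ≡ 2 ^ suc m ℕ.∸ 1))
corollary4 m n 2^m≤n n<2^[1+m] =
  lowerBound≤v R , v≤upperBound R 2^m≤n , lowerBound≡v⇔ R , v≡upperBound⇔ R 2^m≤n
  where
  R : ReversedDigits m n
  R = reversedDigits m n 2^m≤n n<2^[1+m]
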